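{- Let $\lambda=(\lambda_1,\dots,\lambda_m)$ be a partition, let $T$ be a standard Young tableau of shape $\lambda$, and let $P=(v_0,v_1,\dots)$ be the associated $m$-dimensional Dyck path. Then for each entry $k$ of $T$ and each integer $d\ge0$, $\operatorname{dep}(k)=d$ if and only if $P$ has a $d$-degree return to ground at $v_k$.
   Context: A standard Young tableau of shape $\lambda$ is a filling of the Young diagram (rows of lengths $\lambda_1\ge\dots\ge\lambda_m$, top to bottom) by $1,\dots,N$ increasing along rows and down columns. For an entry $k$ in column $j$, $\operatorname{dep}(k)$ is the number of entries of column $j$ smaller than $k$ minus the number of entries of column $j+1$ smaller than $k$ (the latter $0$ if there is no column $j+1$). The associated path has $v_0=0\in\mathbb{Z}^m$ and $v_k=v_{k-1}+\hat e_r$ where $r$ is the row containing $k$; every $v_k=(x_1,\dots,x_m)$ satisfies $x_1\ge\dots\ge x_m$. If $v_k-v_{k-1}=\hat e_\gamma$ and $v_k=(x'_1,\dots,x'_m)$, then $P$ has a $d$-degree return to ground (in coordinate $\gamma$) at $v_k$ if $x'_{\gamma-d}=x'_{\gamma-d+1}=\dots=x'_\gamma$ and either $\gamma-d=1$ or $x'_{\gamma-d-1}\ne x'_\gamma$. -}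

module Defs where

open import Data.Nat using (ℕ; zero; suc; _+_; _∸_; _≤_; _<_; _<?_)
open import Data.Integer using (ℤ; +_; _-_)
open import Data.Fin using (Fin; toℕ; _≟_)
open import Data.List using (List; length; filter; map; allFin)
open import Data.Nat.ListAction using (sum)
open import Data.Product using (Σ; ∃; ∃-syntax; _×_; _,_)
open import Data.Sum using (_⊎_)
open import Data.Bool using (if_then_else_)
open import Relation.Nullary using (¬_)
open import Relation.Nullary.Decidable using (⌊_⌋; _×-dec_)
open import Relation.Binary.PropositionalEquality using (_≡_; _≢_)

-- Rows are indexed 0,…,m-1 by Fin m (row i here = row i+1 of the paper);
-- columns are indexed 0,1,… by ℕ (column j here = column j+1 of the paper).

IsPartition : (m : ℕ) → (Fin m → ℕ) → Set
IsPartition m λs =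
  (∀ (i j : Fin m) → toℕ i ≤ toℕ j → λs j ≤ λs i) × (∀ (i : Fin m) → 1 ≤ λs i)

size : (m : ℕ) → (Fin m → ℕ) → ℕ
size m λs = sum (map λs (allFin m))

-- A filling T (T i j = entry in row i, column j; values outside the
-- diagram are irrelevant) is a standard Young tableau of shape λ.
IsSYT : (m : ℕ) → (λs : Fin m → ℕ) → (Fin m → ℕ → ℕ) → Set
IsSYT m λs T =
  (∀ (i : Fin m) (j : ℕ) → j < λs i → 1 ≤ T i j × T i j ≤ size m λs)
  × (∀ (i i' : Fin m) (j j' : ℕ) → j < λs i → j' < λs i' →
       T i j ≡ T i' j' → i ≡ i' × j ≡ j')
  × (∀ (k : ℕ) → 1 ≤ k → k ≤ size m λs → ∃[ i ] ∃[ j ] (j < λs i × T i j ≡ k))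
  × (∀ (i : Fin m) (j : ℕ) → suc j < λs i → T i j < T i (suc j))
  × (∀ (i i' : Fin m) (j : ℕ) → toℕ i' ≡ suc (toℕ i) → j < λs i' →
       T i j < T i' j)

colBelow : (m : ℕ) → (Fin m → ℕ) → (Fin m → ℕ → ℕ) → ℕ → ℕ → ℕ
colBelow m λs T j k =
  length (filter (λ i → (j <? λs i) ×-dec (T i j <? k)) (allFin m))

-- dep(k) for an entry k lying in column j
dep : (m : ℕ) → (Fin m → ℕ) → (Fin m → ℕ → ℕ) → (j k : ℕ) → ℤ
dep m λs T j k = + colBelow m λs T j k - + colBelow m λs T (suc j) k

unitVec : {m : ℕ} → Fin m → Fin m → ℕ
unitVec r i = if ⌊ i ≟ r ⌋ then 1 else 0

-- v : ℕ → ℤ^m (with nonnegative coordinates, stored in ℕ) is the path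
-- associated with T: v₀ = 0 and v_k = v_{k-1} + ê_r where r is the row of k.
IsAssociatedPath : (m : ℕ) → (λs : Fin m → ℕ) → (Fin m → ℕ → ℕ) →
                   (ℕ → Fin m → ℕ) → Set
IsAssociatedPath m λs T v =
  (∀ (i : Fin m) → v 0 i ≡ 0)
  × (∀ (k : ℕ) (r : Fin m) (c : ℕ) → c < λs r → T r c ≡ k →
       ∀ (i : Fin m) → v k i ≡ v (k ∸ 1) i + unitVec r i)

-- x has a d-degree return to ground in coordinate γ (0-indexed):
-- x_{γ-d} = … = x_γ, and either γ-d is the first coordinate or
-- x_{γ-d-1} ≠ x_γ.
ReturnToGroundIn : {m : ℕ} → (Fin m → ℕ) → Fin m → ℕ → Set
ReturnToGroundIn x γ d =
  d ≤ toℕ γ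
  × (∀ i → toℕ γ ∸ d ≤ toℕ i → toℕ i ≤ toℕ γ → x i ≡ x γ)
  × (toℕ γ ∸ d ≡ 0 ⊎ ∃[ i ] (suc (toℕ i) ≡ toℕ γ ∸ d × x i ≢ x γ))

HasReturnToGround : {m : ℕ} → (ℕ → Fin m → ℕ) → ℕ → ℕ → Set
HasReturnToGround v k d =
  1 ≤ k × ∃[ γ ] ((∀ i → v k i ≡ v (k ∸ 1) i + unitVec γ i)
                  × ReturnToGroundIn (v k) γ d)

-- At time k = T r c the path has x_r = c + 1, and a row i ≤ r has x_i = x_r
-- unless its column-(c+1) cell holds an entry smaller than k.  Those rows form
-- an initial segment 0 … s-1 of the rows above r, so the coordinates equal to
-- x_r are exactly s … r and the return has degree r - s.  On the other side,
-- the entries of column c smaller than k are those of rows 0 … r-1 and the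
-- entries of column c+1 smaller than k are those of rows 0 … s-1, so
-- dep(k) = r - s as well.
module Submission where

open import Defs
open import Level using (0ℓ)
open import Data.Nat using (ℕ; zero; suc; _+_; _∸_; _≤_; _<_; _<?_; z≤n; s≤s; z<s; s≤s⁻¹)
open import Data.Nat.Properties
open import Data.Fin using (Fin; toℕ; fromℕ<) renaming (zero to fz; suc to fs; _≟_ to _≟ᶠ_)
open import Data.Fin.Properties using (toℕ-fromℕ<; toℕ<n; toℕ-injective)
open import Data.Integer using (+_; _-_; _⊖_)
open import Data.Integer.Properties using (+-injective; [+m]-[+n]≡m⊖n; ⊖-≥)
open import Data.List using (length; filter; tabulate)
open import Data.List.Properties using (filter-accept; filter-reject)
open import Data.Product using (∃-syntax; _×_; _,_; proj₁; proj₂)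
open import Data.Sum using (_⊎_; inj₁; inj₂)
open import Data.Empty using (⊥-elim)
open import Function using (_∘_; id)
open import Function.Bundles using (_⇔_; mk⇔; Equivalence)
open import Function.Properties.Equivalence using (⇔-setoid) renaming (trans to ⇔-trans; sym to ⇔-sym)
open import Relation.Nullary using (¬_; yes; no; contradiction)
open import Relation.Nullary.Decidable using (_×-dec_)
open import Relation.Unary using (Pred; Decidable)
open import Relation.Binary.PropositionalEquality
open import Relation.Binary.Definitions using (tri<; tri≈; tri>)
import Relation.Binary.Reasoning.Setoid as SetoidReasoning

open Equivalence using (to; from)

<-extensional : ∀ {a b} → (∀ c → c < a ⇔ c < b) → a ≡ b
<-extensional {a} {b} same = ≤-antisym
  (≮⇒≥ λ b<a → n≮n b (to (same b) b<a))
  (≮⇒≥ λ a<b → n≮n a (from (same a) a<b))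

module _ {a ℓ} {A : Set a} {P : Pred A ℓ} (P? : Decidable P) where

  length-filter-tabulate : ∀ {n} (g : Fin n → A) {t} → t ≤ n →
    (∀ i → P (g i) ⇔ toℕ i < t) → length (filter P? (tabulate g)) ≡ t
  length-filter-tabulate {zero} g z≤n _ = refl
  length-filter-tabulate {suc n} g {zero} _ seg =
    trans (cong length (filter-reject P? (n≮0 ∘ to (seg fz))))
          (length-filter-tabulate (g ∘ fs) z≤n (λ i → mk⇔ (⊥-elim ∘ n≮0 ∘ to (seg (fs i))) λ ()))
  length-filter-tabulate {suc n} g {suc t} (s≤s t≤n) seg =
    trans (cong length (filter-accept P? (from (seg fz) z<s)))
          (cong suc (length-filter-tabulate (g ∘ fs) t≤n
            (λ i → mk⇔ (s≤s⁻¹ ∘ to (seg (fs i))) (from (seg (fs i)) ∘ s≤s))))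

downwardClosed⇒initialSegment : ∀ {n ℓ} {P : Pred (Fin n) ℓ} → Decidable P →
  (∀ {i j} → toℕ i ≤ toℕ j → P j → P i) →
  ∃[ t ] (t ≤ n × (∀ i → P i ⇔ toℕ i < t))
downwardClosed⇒initialSegment {zero} _ _ = 0 , z≤n , λ ()
downwardClosed⇒initialSegment {suc n} P? down with P? fz
... | no ¬p₀ = 0 , z≤n , λ i → mk⇔ (⊥-elim ∘ ¬p₀ ∘ down z≤n) λ ()
... | yes p₀ with downwardClosed⇒initialSegment (P? ∘ fs) (down ∘ s≤s)
... | t , t≤n , seg = suc t , s≤s t≤n , λ where
  fz     → mk⇔ (λ _ → z<s) (λ _ → p₀)
  (fs i) → mk⇔ (s≤s ∘ to (seg i)) (from (seg i) ∘ s≤s⁻¹)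

unitVec-diag : ∀ {m} (r : Fin m) → unitVec r r ≡ 1
unitVec-diag r with r ≟ᶠ r
... | yes _  = refl
... | no r≢r = contradiction refl r≢r

unitVec-offdiag : ∀ {m} {r i : Fin m} → i ≢ r → unitVec r i ≡ 0
unitVec-offdiag {r = r} {i} i≢r with i ≟ᶠ r
... | yes i≡r = contradiction i≡r i≢r
... | no _    = refl

unitVec≡1⇒≡ : ∀ {m} {γ i : Fin m} → unitVec γ i ≡ 1 → i ≡ γ
unitVec≡1⇒≡ {γ = γ} {i} e with i ≟ᶠ γ
... | yes i≡γ = i≡γ
... | no _ with e
...   | ()

step-direction-unique : ∀ {m} {u w : Fin m → ℕ} {γ r : Fin m} →
  (∀ i → w i ≡ u i + unitVec γ i) → (∀ i → w i ≡ u i + unitVec r i) → γ ≡ r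
step-direction-unique {u = u} {γ = γ} {r} stepγ stepr = sym (unitVec≡1⇒≡ (begin
  unitVec γ r ≡⟨ +-cancelˡ-≡ (u r) _ _ (trans (sym (stepγ r)) (stepr r)) ⟩
  unitVec r r ≡⟨ unitVec-diag r ⟩
  1           ∎))
  where open ≡-Reasoning

hasReturnToGround⇔ : ∀ {m} {v : ℕ → Fin m → ℕ} {k d : ℕ} {r : Fin m} → 1 ≤ k →
  (∀ i → v k i ≡ v (k ∸ 1) i + unitVec r i) →
  HasReturnToGround v k d ⇔ ReturnToGroundIn (v k) r d
hasReturnToGround⇔ {v = v} {k} {d} 1≤k stepr = mk⇔
  (λ (_ , γ , stepγ , rtg) →
    subst (λ γ → ReturnToGroundIn (v k) γ d) (step-direction-unique stepγ stepr) rtg)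
  (λ rtg → 1≤k , _ , stepr , rtg)

returnToGroundIn⇔ : ∀ {m} {x : Fin m → ℕ} {γ : Fin m} {s d : ℕ} → s ≤ toℕ γ →
  (∀ i → toℕ i ≤ toℕ γ → (x i ≡ x γ ⇔ s ≤ toℕ i)) →
  ReturnToGroundIn x γ d ⇔ d ≡ toℕ γ ∸ s
returnToGroundIn⇔ {m} {x} {γ} {s} {d} s≤γ block = mk⇔ degree exhibit
  where
  row : ∀ {t} → t ≤ toℕ γ → Fin m
  row t≤γ = fromℕ< (≤-<-trans t≤γ (toℕ<n γ))

  toℕ-row : ∀ {t} (t≤γ : t ≤ toℕ γ) → toℕ (row t≤γ) ≡ t
  toℕ-row t≤γ = toℕ-fromℕ< (≤-<-trans t≤γ (toℕ<n γ))

  row≤γ : ∀ {t} (t≤γ : t ≤ toℕ γ) → toℕ (row t≤γ) ≤ toℕ γ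
  row≤γ t≤γ = subst (_≤ toℕ γ) (sym (toℕ-row t≤γ)) t≤γ

  start≡s : ReturnToGroundIn x γ d → toℕ γ ∸ d ≡ s
  start≡s (_ , flat , edge) with <-cmp (toℕ γ ∸ d) s
  ... | tri≈ _ start≡s _ = start≡s
  ... | tri< start<s _ _ = contradiction (to (block i i≤γ) (flat i start≤i i≤γ)) (<⇒≱ i<s)
    where
    start≤γ : toℕ γ ∸ d ≤ toℕ γ
    start≤γ = m∸n≤m (toℕ γ) d
    i : Fin m
    i = row start≤γ
    i≤γ : toℕ i ≤ toℕ γ
    i≤γ = row≤γ start≤γ
    start≤i : toℕ γ ∸ d ≤ toℕ i
    start≤i = ≤-reflexive (sym (toℕ-row start≤γ))
    i<s : toℕ i < s
    i<s = subst (_< s) (sym (toℕ-row start≤γ)) start<s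
  ... | tri> _ _ s<start with edge
  ...   | inj₁ start≡0 = contradiction (subst (s <_) start≡0 s<start) n≮0
  ...   | inj₂ (i , 1+i≡start , xi≢xγ) =
    contradiction (from (block i i≤γ) (s≤s⁻¹ (subst (s <_) (sym 1+i≡start) s<start))) xi≢xγ
    where
    i≤γ : toℕ i ≤ toℕ γ
    i≤γ = ≤-trans (n≤1+n (toℕ i)) (subst (_≤ toℕ γ) (sym 1+i≡start) (m∸n≤m (toℕ γ) d))

  degree : ReturnToGroundIn x γ d → d ≡ toℕ γ ∸ s
  degree rtg = trans (sym (m∸[m∸n]≡n (proj₁ rtg))) (cong (toℕ γ ∸_) (start≡s rtg))

  edge : ∀ {t} → t ≡ s → t ≡ 0 ⊎ ∃[ i ] (suc (toℕ i) ≡ t × x i ≢ x γ)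
  edge {zero}  _    = inj₁ refl
  edge {suc t} refl = inj₂ (row t≤γ , cong suc (toℕ-row t≤γ) , λ xi≡xγ →
    n≮n t (subst (s ≤_) (toℕ-row t≤γ) (to (block (row t≤γ) (row≤γ t≤γ)) xi≡xγ)))
    where
    t≤γ : t ≤ toℕ γ
    t≤γ = ≤-trans (n≤1+n t) s≤γ

  exhibit : d ≡ toℕ γ ∸ s → ReturnToGroundIn x γ d
  exhibit refl = m∸n≤m (toℕ γ) s , flat , edge (m∸[m∸n]≡n s≤γ)
    where
    flat : ∀ i → toℕ γ ∸ (toℕ γ ∸ s) ≤ toℕ i → toℕ i ≤ toℕ γ → x i ≡ x γ
    flat i start≤i i≤γ = from (block i i≤γ) (subst (_≤ toℕ i) (m∸[m∸n]≡n s≤γ) start≤i)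

module Tableau {m : ℕ} {λs : Fin m → ℕ} {T : Fin m → ℕ → ℕ}
  (isP : IsPartition m λs) (isS : IsSYT m λs T) where

  rows-shorten : ∀ i i' → toℕ i ≤ toℕ i' → λs i' ≤ λs i
  rows-shorten = proj₁ isP

  entries-positive : ∀ i c → c < λs i → 1 ≤ T i c
  entries-positive i c c<λ = proj₁ (proj₁ isS i c c<λ)

  entries-bounded : ∀ i c → c < λs i → T i c ≤ size m λs
  entries-bounded i c c<λ = proj₂ (proj₁ isS i c c<λ)

  entries-injective : ∀ i i' c c' → c < λs i → c' < λs i' → T i c ≡ T i' c' → i ≡ i' × c ≡ c'
  entries-injective = proj₁ (proj₂ isS)

  entries-cover : ∀ k → 1 ≤ k → k ≤ size m λs → ∃[ i ] ∃[ c ] (c < λs i × T i c ≡ k)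
  entries-cover = proj₁ (proj₂ (proj₂ isS))

  row-step : ∀ i c → suc c < λs i → T i c < T i (suc c)
  row-step = proj₁ (proj₂ (proj₂ (proj₂ isS)))

  col-step : ∀ i i' c → toℕ i' ≡ suc (toℕ i) → c < λs i' → T i c < T i' c
  col-step = proj₂ (proj₂ (proj₂ (proj₂ isS)))

  inShape-above : ∀ {i i' c} → toℕ i ≤ toℕ i' → c < λs i' → c < λs i
  inShape-above {i} {i'} i≤i' c<λ = <-≤-trans c<λ (rows-shorten i i' i≤i')

  row-< : ∀ i {c c'} → c < c' → c' < λs i → T i c < T i c'
  row-< i {c} {suc c'} c<1+c' c'<λ with m≤n⇒m<n∨m≡n (s≤s⁻¹ c<1+c')
  ... | inj₁ c<c' = <-trans (row-< i c<c' (<-trans (n<1+n c') c'<λ)) (row-step i c' c'<λ)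
  ... | inj₂ refl = row-step i c c'<λ

  row-≤ : ∀ i {c c'} → c ≤ c' → c' < λs i → T i c ≤ T i c'
  row-≤ i c≤c' c'<λ with m≤n⇒m<n∨m≡n c≤c'
  ... | inj₁ c<c' = <⇒≤ (row-< i c<c' c'<λ)
  ... | inj₂ refl = ≤-refl

  col-<-at-distance : ∀ n {i i'} c → toℕ i' ≡ n + suc (toℕ i) → c < λs i' → T i c < T i' c
  col-<-at-distance zero    c i'≡ c<λ = col-step _ _ c i'≡ c<λ
  col-<-at-distance (suc n) {i} {i'} c i'≡ c<λ =
    <-trans (col-<-at-distance n c (toℕ-fromℕ< j<m) (inShape-above j≤i' c<λ))
            (col-step j i' c (trans i'≡ (cong suc (sym (toℕ-fromℕ< j<m)))) c<λ)
    where
    j<m : n + suc (toℕ i) < m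
    j<m = <-trans (subst (n + suc (toℕ i) <_) (sym i'≡) (n<1+n _)) (toℕ<n i')
    j : Fin m
    j = fromℕ< j<m
    j≤i' : toℕ j ≤ toℕ i'
    j≤i' = subst (_≤ toℕ i') (sym (toℕ-fromℕ< j<m)) (subst (_ ≤_) (sym i'≡) (n≤1+n _))

  col-< : ∀ {i i'} c → toℕ i < toℕ i' → c < λs i' → T i c < T i' c
  col-< {i} {i'} c i<i' = col-<-at-distance (toℕ i' ∸ suc (toℕ i)) c (sym (m∸n+n≡m i<i'))

  col-≤ : ∀ {i i'} c → toℕ i ≤ toℕ i' → c < λs i' → T i c ≤ T i' c
  col-≤ c i≤i' c<λ with m≤n⇒m<n∨m≡n i≤i'
  ... | inj₁ i<i' = <⇒≤ (col-< c i<i' c<λ)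
  ... | inj₂ i≡i' rewrite toℕ-injective i≡i' = ≤-refl

  row-<⇔ : ∀ {i c c'} → c' < λs i → (c < λs i × T i c < T i c') ⇔ c < c'
  row-<⇔ {i} c'<λ = mk⇔
    (λ (c<λ , Tc<Tc') → ≰⇒> (λ c'≤c → <⇒≱ Tc<Tc' (row-≤ i c'≤c c<λ)))
    (λ c<c' → <-trans c<c' c'<λ , row-< i c<c' c'<λ)

  row-≤⇔ : ∀ {i c c'} → c' < λs i → (c < λs i × T i c ≤ T i c') ⇔ c ≤ c'
  row-≤⇔ {i} c'<λ = mk⇔
    (λ (c<λ , Tc≤Tc') → ≮⇒≥ (λ c'<c → <⇒≱ (row-< i c'<c c<λ) Tc≤Tc'))
    (λ c≤c' → ≤-<-trans c≤c' c'<λ , row-≤ i c≤c' c'<λ)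

  col-<⇔ : ∀ {i i' c} → c < λs i' → (c < λs i × T i c < T i' c) ⇔ toℕ i < toℕ i'
  col-<⇔ {c = c} c<λ = mk⇔
    (λ (c<λi , Ti<Ti') → ≰⇒> (λ i'≤i → <⇒≱ Ti<Ti' (col-≤ c i'≤i c<λi)))
    (λ i<i' → inShape-above (<⇒≤ i<i') c<λ , col-< c i<i' c<λ)

  -- n is the number of entries ≤ k in row i; they occupy its first n cells.
  RowCount : ℕ → Fin m → ℕ → Set
  RowCount k i n = ∀ c → c < n ⇔ (c < λs i × T i c ≤ k)

  rowCount-unique : ∀ {k i a b} → RowCount k i a → RowCount k i b → a ≡ b
  rowCount-unique countsᵃ countsᵇ = <-extensional λ c → ⇔-trans (countsᵃ c) (⇔-sym (countsᵇ c))

  rowCount-zero : ∀ i → RowCount 0 i 0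
  rowCount-zero i c = mk⇔ (λ ())
    (λ (c<λ , Tc≤0) → ⊥-elim (n≮0 (≤-trans (entries-positive i c c<λ) Tc≤0)))

  rowCount-at : ∀ {i c} → c < λs i → RowCount (T i c) i (suc c)
  rowCount-at c<λ c' = ⇔-trans (mk⇔ s≤s⁻¹ s≤s) (⇔-sym (row-≤⇔ c<λ))

  rowCount-before : ∀ {i c k} → c < λs i → T i c ≡ suc k → RowCount k i c
  rowCount-before {i} {c} c<λ Tc≡1+k c' = ⇔-trans (⇔-sym (row-<⇔ c<λ)) (mk⇔
    (λ (c'<λ , Tc'<Tc) → c'<λ , s≤s⁻¹ (subst (T i c' <_) Tc≡1+k Tc'<Tc))
    (λ (c'<λ , Tc'≤k) → c'<λ , subst (T i c' <_) (sym Tc≡1+k) (s≤s Tc'≤k)))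

  rowCount-suc : ∀ {k i n} → RowCount k i n → (∀ c → c < λs i → T i c ≢ suc k) →
    RowCount (suc k) i n
  rowCount-suc counts absent c = ⇔-trans (counts c) (mk⇔
    (λ (c<λ , Tc≤k) → c<λ , m≤n⇒m≤1+n Tc≤k)
    (λ (c<λ , Tc≤1+k) → c<λ , s≤s⁻¹ (≤∧≢⇒< Tc≤1+k (absent c c<λ))))

  rowCount-addEntry : ∀ {k r c} {u w : Fin m → ℕ} → c < λs r → T r c ≡ suc k →
    (∀ i → RowCount k i (u i)) → (∀ i → w i ≡ u i + unitVec r i) →
    ∀ i → RowCount (suc k) i (w i)
  rowCount-addEntry {k} {r} {c} {u} {w} c<λ Trc≡1+k counts step i with i ≟ᶠ r
  ... | yes refl = subst (RowCount (suc k) i) (sym wi≡1+c)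
                     (subst (λ t → RowCount t i (suc c)) Trc≡1+k (rowCount-at c<λ))
    where
    open ≡-Reasoning
    wi≡1+c : w i ≡ suc c
    wi≡1+c = begin
      w i               ≡⟨ step i ⟩
      u i + unitVec i i ≡⟨ cong₂ _+_ (rowCount-unique (counts i) (rowCount-before c<λ Trc≡1+k))
                                     (unitVec-diag i) ⟩
      c + 1             ≡⟨ +-comm c 1 ⟩
      suc c             ∎
  ... | no i≢r = subst (RowCount (suc k) i) (sym wi≡ui) (rowCount-suc (counts i) absent)
    where
    wi≡ui : w i ≡ u i
    wi≡ui = trans (step i) (trans (cong (λ e → u i + e) (unitVec-offdiag i≢r)) (+-identityʳ (u i)))
    absent : ∀ c' → c' < λs i → T i c' ≢ suc k
    absent c' c'<λ Tc'≡1+k =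
      i≢r (proj₁ (entries-injective i r c' c c'<λ c<λ (trans Tc'≡1+k (sym Trc≡1+k))))

module Path {m : ℕ} {λs : Fin m → ℕ} {T : Fin m → ℕ → ℕ} {v : ℕ → Fin m → ℕ}
  (isP : IsPartition m λs) (isS : IsSYT m λs T) (isA : IsAssociatedPath m λs T v) where

  open Tableau isP isS

  path-rowCount : ∀ {k} → k ≤ size m λs → ∀ i → RowCount k i (v k i)
  path-rowCount {zero} _ i = subst (RowCount 0 i) (sym (proj₁ isA i)) (rowCount-zero i)
  path-rowCount {suc k} 1+k≤N with entries-cover (suc k) (s≤s z≤n) 1+k≤N
  ... | r , c , c<λ , Trc≡1+k =
    rowCount-addEntry c<λ Trc≡1+k (path-rowCount (<⇒≤ 1+k≤N)) (proj₂ isA (suc k) r c c<λ Trc≡1+k)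

  module AtEntry {r : Fin m} {c : ℕ} (c<λ : c < λs r) where

    k : ℕ
    k = T r c

    x : Fin m → ℕ
    x = v k

    counts : ∀ i → RowCount k i (x i)
    counts = path-rowCount (entries-bounded r c c<λ)

    x-r : x r ≡ suc c
    x-r = rowCount-unique (counts r) (rowCount-at c<λ)

    path-step : ∀ i → v k i ≡ v (k ∸ 1) i + unitVec r i
    path-step = proj₂ isA k r c c<λ refl

    Ahead : Fin m → Set
    Ahead i = suc c < λs i × T i (suc c) < k

    ahead? : Decidable Ahead
    ahead? i = (suc c <? λs i) ×-dec (T i (suc c) <? k)

    ahead-downwardClosed : ∀ {i i'} → toℕ i ≤ toℕ i' → Ahead i' → Ahead i
    ahead-downwardClosed i≤i' (1+c<λ , lt) =
      inShape-above i≤i' 1+c<λ , ≤-<-trans (col-≤ (suc c) i≤i' 1+c<λ) lt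

    ¬ahead-r : ¬ Ahead r
    ¬ahead-r (1+c<λ , lt) = <-asym (row-step r c 1+c<λ) lt

    x≡x-r⇔¬ahead : ∀ {i} → toℕ i ≤ toℕ r → (x i ≡ x r ⇔ (¬ Ahead i))
    x≡x-r⇔¬ahead {i} i≤r = mk⇔ level⇒¬ahead ¬ahead⇒level
      where
      c<xi : c < x i
      c<xi = from (counts i c) (inShape-above i≤r c<λ , col-≤ c i≤r c<λ)

      level⇒¬ahead : x i ≡ x r → ¬ Ahead i
      level⇒¬ahead xi≡xr (1+c<λ , lt) =
        n≮n (suc c) (subst (suc c <_) (trans xi≡xr x-r) (from (counts i (suc c)) (1+c<λ , <⇒≤ lt)))

      -- The cell (i, c+1) cannot hold k itself, which sits at (r, c).
      ahead-beyond : suc c < x i → Ahead i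
      ahead-beyond 1+c<xi =
        let (1+c<λ , T≤k) = to (counts i (suc c)) 1+c<xi
        in 1+c<λ , ≤∧≢⇒< T≤k (λ T≡k → 1+n≢n (proj₂ (entries-injective i r (suc c) c 1+c<λ c<λ T≡k)))

      ¬ahead⇒level : ¬ Ahead i → x i ≡ x r
      ¬ahead⇒level ¬ahead = trans (≤-antisym (≮⇒≥ (¬ahead ∘ ahead-beyond)) c<xi) (sym x-r)

    aheadRows : ∃[ s ] (s ≤ m × (∀ i → Ahead i ⇔ toℕ i < s))
    aheadRows = downwardClosed⇒initialSegment ahead? ahead-downwardClosed

    s : ℕ
    s = proj₁ aheadRows

    ahead⇔<s : ∀ i → Ahead i ⇔ toℕ i < s
    ahead⇔<s = proj₂ (proj₂ aheadRows)

    s≤r : s ≤ toℕ r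
    s≤r = ≮⇒≥ (¬ahead-r ∘ from (ahead⇔<s r))

    level-block : ∀ i → toℕ i ≤ toℕ r → (x i ≡ x r ⇔ s ≤ toℕ i)
    level-block i i≤r = ⇔-trans (x≡x-r⇔¬ahead i≤r) (mk⇔
      (λ ¬ahead → ≮⇒≥ (¬ahead ∘ from (ahead⇔<s i)))
      (λ s≤i ahead → <⇒≱ (to (ahead⇔<s i) ahead) s≤i))

    dep-value : dep m λs T c k ≡ + (toℕ r ∸ s)
    dep-value = begin
      dep m λs T c k   ≡⟨ cong₂ (λ a b → + a - + b) below-c below-1+c ⟩
      + toℕ r - + s    ≡⟨ [+m]-[+n]≡m⊖n (toℕ r) s ⟩
      toℕ r ⊖ s        ≡⟨ ⊖-≥ s≤r ⟩
      + (toℕ r ∸ s)    ∎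
      where
      open ≡-Reasoning
      below-c : colBelow m λs T c k ≡ toℕ r
      below-c = length-filter-tabulate (λ i → (c <? λs i) ×-dec (T i c <? k)) id
                  (<⇒≤ (toℕ<n r)) (λ i → col-<⇔ c<λ)
      below-1+c : colBelow m λs T (suc c) k ≡ s
      below-1+c = length-filter-tabulate ahead? id (proj₁ (proj₂ aheadRows)) ahead⇔<s

    dep≡⇔ : ∀ {d} → (dep m λs T c k ≡ + d) ⇔ (d ≡ toℕ r ∸ s)
    dep≡⇔ = mk⇔ (λ dep≡d → sym (+-injective (trans (sym dep-value) dep≡d)))
                (λ d≡ → trans dep-value (cong +_ (sym d≡)))

mainTheorem14 : (m : ℕ) (λs : Fin m → ℕ) (T : Fin m → ℕ → ℕ) (v : ℕ → Fin m → ℕ) →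
    IsPartition m λs → IsSYT m λs T → IsAssociatedPath m λs T v →
    ∀ (r : Fin m) (c : ℕ) → c < λs r → ∀ (d : ℕ) →
    (dep m λs T c (T r c) ≡ + d) ⇔ HasReturnToGround v (T r c) d
mainTheorem14 m λs T v isP isS isA r c c<λ d = begin
  (dep m λs T c (T r c) ≡ + d)      ≈⟨ dep≡⇔ ⟩
  (d ≡ toℕ r ∸ s)                   ≈⟨ returnToGroundIn⇔ s≤r level-block ⟨
  ReturnToGroundIn (v (T r c)) r d  ≈⟨ hasReturnToGround⇔ {v = v} (entries-positive r c c<λ) path-step ⟨
  HasReturnToGround v (T r c) d     ∎
  where
  open Tableau isP isS using (entries-positive)
  open Path isP isS isA
  open AtEntry c<λ
  open SetoidReasoning (⇔-setoid 0ℓ)
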